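{- The Shortest-Paths-and-Greedy-Delays algorithm described in the context has approximation ratio \(\Theta(k)\) for min-sum Time Disjoint Walks on directed acyclic graphs (of unrestricted degree): there is a constant \(C\) such that on every instance with \(k\) demands whose digraph is a DAG, and for every way of breaking ties, the output's cost is at most \(C\cdot k\) times the optimal min-sum cost; and there is a constant \(c>0\) such that for every \(k\ge1\) there is an instance with \(k\) demands whose digraph is a DAG, together with a valid way of breaking ties, on which the output's cost is at least \(c\cdot k\) times the optimal min-sum cost.
   Context: Notation: for integers \(a,b\), \([a,b]=\{x\in\mathbb{Z}: a\le x\le b\}\) and \([b]=[1,b]\). Digraphs are finite and have no parallel arcs in the same direction. Let \(G=(V,E)\) be a digraph with arc lengths \(\lambda:E\to\mathbb{Z}_{\ge1}\). A walk from \(u\) to \(v\) is a tuple \(W=(w_1,\dots,w_l)\) of vertices with \(w_1=u\), \(w_l=v\), \((w_i,w_{i+1})\in E\) for all \(i\in[l-1]\) (vertices may repeat). For \(j\in[l]\) let \(\lambda(W,j)=\sum_{i\in[j-1]}\lambda(w_i,w_{i+1})\) and \(\lambda(W)=\lambda(W,l)\); for a path (no repeated vertices) and a vertex \(v=w_j\) on it write \(\lambda(W,v)=\lambda(W,j)\). Given delays \(d_1,d_2\in\mathbb{Z}_{\ge0}\) and walks \(W_1,W_2\), the pairs \((d_1,W_1)\) and \((d_2,W_2)\) are time disjoint if for every \(j_1\in[|W_1|]\), \(j_2\in[|W_2|]\) such that the \(j_1\)-th vertex of \(W_1\) equals the \(j_2\)-th vertex of \(W_2\), we have \(d_1+\lambda(W_1,j_1)\ne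 d_2+\lambda(W_2,j_2)\). Time Disjoint Walks (TDW): an instance is \((G,\lambda,\mathcal{T})\) with \(\mathcal{T}=\{(s_1,t_1),\dots,(s_k,t_k)\}\subseteq V^2\) a set of \(k\) demands across unique vertices, such that for each \(i\) there is a walk from \(s_i\) to \(t_i\). A feasible solution is a choice, for each \(i\in[k]\), of a delay \(d_i\in\mathbb{Z}_{\ge0}\) and a walk \(W_i\) from \(s_i\) to \(t_i\), such that the pairs \((d_i,W_i)\) are pairwise time disjoint. Min-sum TDW minimizes \(\sum_{i\in[k]}(d_i+\lambda(W_i))\). Shortest-Paths-and-Greedy-Delays algorithm: for each \(i\in[k]\), compute a shortest (minimum \(\lambda\)-length) path \(W_i\) from \(s_i\) to \(t_i\) (e.g. by Dijkstra; ties broken arbitrarily). Relabel the demands so that \(\lambda(W_1)\le\lambda(W_2)\le\dots\le\lambda(W_k)\) (ties broken arbitrarily). Then for \(i=1,\dots,k\) in order, let \(B_i=\{d_h+\lambda(W_h,v)-\lambda(W_i,v): h\in[i-1],\ v \text{ a vertex lying on both } W_h \text{ and } W_i\}\) and set \(d_i=\min(\mathbb{Z}_{\ge0}\setminus B_i)\). Output \(\{(d_i,W_i): i\in[k]\}\). -}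

module Defs where

open import Data.Nat using (ℕ; zero; suc; _+_; _*_; _≤_; _<_)
open import Data.Bool using (Bool; true)
open import Data.Fin using (Fin; toℕ)
open import Data.List using (List; []; _∷_; head; last; tabulate)
open import Data.Nat.ListAction using (sum)
open import Data.List.Membership.Propositional using (_∈_)
open import Data.List.Relation.Unary.Unique.Propositional using (Unique)
open import Data.Maybe using (just)
open import Data.Product using (_×_; _,_; Σ; ∃)
open import Data.Unit using (⊤)
open import Data.Empty using (⊥)
open import Relation.Binary.PropositionalEquality using (_≡_; _≢_)
open import Relation.Nullary using (¬_)
open import Function.Definitions using (Injective)

-- A digraph on vertex set Fin n is given by its adjacency function E
-- (arc (u,v) present iff E u v ≡ true; hence no parallel arcs in the same
-- direction).  Arc lengths are a function ℓ, whose values matter only on arcs.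

Arc : {n : ℕ} → (Fin n → Fin n → Bool) → Fin n → Fin n → Set
Arc E u v = E u v ≡ true

PositiveLengths : {n : ℕ} → (Fin n → Fin n → Bool) → (Fin n → Fin n → ℕ) → Set
PositiveLengths E ℓ = ∀ u v → Arc E u v → 1 ≤ ℓ u v

IsWalk : {n : ℕ} → (Fin n → Fin n → Bool) → List (Fin n) → Set
IsWalk E [] = ⊥
IsWalk E (x ∷ []) = ⊤
IsWalk E (x ∷ y ∷ r) = Arc E x y × IsWalk E (y ∷ r)

WalkFromTo : {n : ℕ} → (Fin n → Fin n → Bool) → Fin n → Fin n → List (Fin n) → Set
WalkFromTo E u v W = IsWalk E W × head W ≡ just u × last W ≡ just v

PathFromTo : {n : ℕ} → (Fin n → Fin n → Bool) → Fin n → Fin n → List (Fin n) → Set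
PathFromTo E u v W = WalkFromTo E u v W × Unique W

walkLength : {n : ℕ} → (Fin n → Fin n → ℕ) → List (Fin n) → ℕ
walkLength ℓ [] = 0
walkLength ℓ (x ∷ []) = 0
walkLength ℓ (x ∷ y ∷ r) = ℓ x y + walkLength ℓ (y ∷ r)

timed : {n : ℕ} → (Fin n → Fin n → ℕ) → ℕ → List (Fin n) → List (Fin n × ℕ)
timed ℓ d [] = []
timed ℓ d (x ∷ []) = (x , d) ∷ []
timed ℓ d (x ∷ y ∷ r) = (x , d) ∷ timed ℓ (d + ℓ x y) (y ∷ r)

TimeDisjoint : {n : ℕ} → (Fin n → Fin n → ℕ) → ℕ → List (Fin n) → ℕ → List (Fin n) → Set
TimeDisjoint ℓ d₁ W₁ d₂ W₂ =
  ∀ (v : Fin _) (τ : ℕ) → (v , τ) ∈ timed ℓ d₁ W₁ → ¬ ((v , τ) ∈ timed ℓ d₂ W₂)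

IsDAG : {n : ℕ} → (Fin n → Fin n → Bool) → Set
IsDAG {n} E = ∀ (v : Fin n) (W : List (Fin n)) → WalkFromTo E v v W → ¬ (2 ≤ Data.List.length W)

IsTDWInstance : {n k : ℕ} → (Fin n → Fin n → Bool) → (Fin n → Fin n → ℕ) →
                (Fin k → Fin n) → (Fin k → Fin n) → Set
IsTDWInstance {n} {k} E ℓ s t =
  PositiveLengths E ℓ
  × Injective _≡_ _≡_ s × Injective _≡_ _≡_ t × (∀ i j → s i ≢ t j)
  × (∀ (i : Fin k) → ∃ λ (W : List (Fin n)) → WalkFromTo E (s i) (t i) W)

Feasible : {n k : ℕ} → (Fin n → Fin n → Bool) → (Fin n → Fin n → ℕ) →
           (Fin k → Fin n) → (Fin k → Fin n) →
           (Fin k → ℕ) → (Fin k → List (Fin n)) → Set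
Feasible E ℓ s t d W =
  (∀ i → WalkFromTo E (s i) (t i) (W i))
  × (∀ i j → i ≢ j → TimeDisjoint ℓ (d i) (W i) (d j) (W j))

cost : {n k : ℕ} → (Fin n → Fin n → ℕ) → (Fin k → ℕ) → (Fin k → List (Fin n)) → ℕ
cost ℓ d W = sum (tabulate (λ i → d i + walkLength ℓ (W i)))

ShortestPath : {n : ℕ} → (Fin n → Fin n → Bool) → (Fin n → Fin n → ℕ) →
               Fin n → Fin n → List (Fin n) → Set
ShortestPath {n} E ℓ u v W =
  PathFromTo E u v W × (∀ (W' : List (Fin n)) → PathFromTo E u v W' → walkLength ℓ W ≤ walkLength ℓ W')

-- m ∈ B_i, where "earlier" demands are those h with rank h < rank i:
-- m = d_h + λ(W_h,v) - λ(W_i,v) for a vertex v on both W_h and W_i.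
InB : {n k : ℕ} → (Fin n → Fin n → ℕ) → (Fin k → Fin k) →
      (Fin k → ℕ) → (Fin k → List (Fin n)) → Fin k → ℕ → Set
InB {n} {k} ℓ rank d W i m =
  Σ (Fin k) λ h → toℕ (rank h) < toℕ (rank i) ×
  Σ (Fin n) λ v → Σ ℕ λ a → Σ ℕ λ b →
    (v , a) ∈ timed ℓ 0 (W h) × (v , b) ∈ timed ℓ 0 (W i) × m + b ≡ d h + a

-- A run of Shortest-Paths-and-Greedy-Delays, for some tie-breaking:
-- W i is a shortest s i – t i path (any choice); rank : Fin k → Fin k is a
-- bijective relabelling (position in the processing order) sorted by path
-- length; d i = min (ℕ ∖ B_i).
AlgorithmRun : {n k : ℕ} → (Fin n → Fin n → Bool) → (Fin n → Fin n → ℕ) →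
               (Fin k → Fin n) → (Fin k → Fin n) →
               (Fin k → List (Fin n)) → (Fin k → Fin k) → (Fin k → ℕ) → Set
AlgorithmRun E ℓ s t W rank d =
  (∀ i → ShortestPath E ℓ (s i) (t i) (W i))
  × Injective _≡_ _≡_ rank
  × (∀ i j → toℕ (rank i) < toℕ (rank j) → walkLength ℓ (W i) ≤ walkLength ℓ (W j))
  × (∀ i → ¬ InB ℓ rank d W i (d i))
  × (∀ i m → m < d i → InB ℓ rank d W i m)

module Submission where

-- The greedy delay d_i is the least number outside
-- B_i, so d_i ≤ |B_i|.  Since W_i is a path, a vertex v determines its time
-- on W_i, so every element of B_i is produced by some timed vertex of some
-- W_h: |B_i| ≤ Σ_h |W_h|.  With positive lengths and s_h ≠ t_h a walk has
-- at most 2 λ(W_h) vertices, and in a DAG every walk is a path, so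
-- λ(W_h) ≤ λ(W′_h) for any feasible (d′,W′).  Hence d_i ≤ 2 OPT and
-- λ(W_i) ≤ OPT, and summing over the k demands gives cost ≤ 3 k OPT.
--
-- In a layered digraph (arcs go up in height,
-- length = height difference) every walk takes exactly the height difference,
-- so all paths are shortest.  The star with sources at height 0, one centre at
-- height 1 and sinks at height 2 admits the tie-breaking that routes every
-- demand through the centre; the greedy delays are then 0,1,…,k-1, whereas the
-- direct arcs s_i → t_i with zero delays are feasible.  Costs: Σ_i (i + 2)
-- against 2k.

open import Defs
open import Data.Nat using (ℕ; zero; suc; _+_; _*_; _∸_; _≤_; _<_; _<ᵇ_; z≤n; s≤s; s≤s⁻¹)
open import Data.Nat.Properties
open import Data.Nat.ListAction using (sum)
open import Data.Nat.Tactic.RingSolver using (solve-∀)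
open import Data.Bool using (Bool)
open import Data.Bool.Properties using (T-≡)
open import Data.Fin using (Fin; toℕ; fromℕ<; _↑ˡ_; _↑ʳ_; splitAt) renaming (zero to fz; suc to fs)
import Data.Fin.Properties as FinP
open import Data.List using (List; []; _∷_; length; tabulate; concat; map; lookup; last)
open import Data.List.Properties using (length-++; length-map; tabulate-cong; map-tabulate)
open import Data.List.Membership.Propositional using (_∈_)
open import Data.List.Membership.Propositional.Properties using (∈-concat⁺′; ∈-tabulate⁺; ∈-map⁺)
open import Data.List.Relation.Unary.Any using (here; there; index)
open import Data.List.Relation.Unary.Any.Properties using (lookup-index)
open import Data.List.Relation.Unary.All as All using ([]; _∷_)
open import Data.List.Relation.Unary.AllPairs using ([]; _∷_)
open import Data.List.Relation.Unary.Unique.Propositional using (Unique)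
open import Data.Maybe using (just)
open import Data.Maybe.Properties using (just-injective)
open import Data.Product using (_×_; _,_; Σ; proj₁; proj₂)
open import Data.Sum using ([_,_]′)
open import Data.Unit using (tt)
open import Data.Empty using (⊥; ⊥-elim)
open import Relation.Nullary using (¬_; yes; no)
open import Relation.Binary.PropositionalEquality
open import Function using (_∘_; id)
open import Function.Bundles using (Equivalence)
open import Function.Definitions using (Injective)

∑ : ∀ {k} → (Fin k → ℕ) → ℕ
∑ f = sum (tabulate f)

∑-cong : ∀ {k} {f g : Fin k → ℕ} → (∀ i → f i ≡ g i) → ∑ f ≡ ∑ g
∑-cong f≗g = cong sum (tabulate-cong f≗g)

∑-mono : ∀ {k} {f g : Fin k → ℕ} → (∀ i → f i ≤ g i) → ∑ f ≤ ∑ g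
∑-mono {zero} _ = z≤n
∑-mono {suc k} f≤g = +-mono-≤ (f≤g fz) (∑-mono (f≤g ∘ fs))

term≤∑ : ∀ {k} (f : Fin k → ℕ) i → f i ≤ ∑ f
term≤∑ f fz = m≤m+n _ _
term≤∑ f (fs i) = ≤-trans (term≤∑ (f ∘ fs) i) (m≤n+m _ _)

∑-const : ∀ k c → ∑ {k} (λ _ → c) ≡ k * c
∑-const zero c = refl
∑-const (suc k) c = cong (c +_) (∑-const k c)

∑-scale : ∀ {k} c (f : Fin k → ℕ) → ∑ (λ i → c * f i) ≡ c * ∑ f
∑-scale {zero} c f = sym (*-zeroʳ c)
∑-scale {suc k} c f =
  trans (cong (c * f fz +_) (∑-scale c (f ∘ fs))) (sym (*-distribˡ-+ c (f fz) _))

∑-index-offset : ∀ k c → 2 * ∑ {k} (λ i → toℕ i + c) + k ≡ k * k + 2 * c * k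
∑-index-offset zero c = sym (*-zeroʳ (2 * c))
∑-index-offset (suc k) c = begin
  2 * (c + ∑ {k} (λ i → suc (toℕ i) + c)) + suc k
    ≡⟨ cong (λ S → 2 * (c + S) + suc k) (∑-cong {k} (λ i → sym (+-suc (toℕ i) c))) ⟩
  2 * (c + S′) + suc k                        ≡⟨ split c k S′ ⟩
  (2 * S′ + k) + (2 * c + 1)                  ≡⟨ cong (_+ (2 * c + 1)) (∑-index-offset k (suc c)) ⟩
  (k * k + 2 * suc c * k) + (2 * c + 1)       ≡⟨ square c k ⟩
  suc k * suc k + 2 * c * suc k               ∎
  where
  open ≡-Reasoning
  S′ : ℕ
  S′ = ∑ {k} (λ i → toℕ i + suc c)
  split : ∀ c k S → 2 * (c + S) + suc k ≡ (2 * S + k) + (2 * c + 1)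
  split = solve-∀
  square : ∀ c k → (k * k + 2 * suc c * k) + (2 * c + 1) ≡ suc k * suc k + 2 * c * suc k
  square = solve-∀

length-concat : ∀ {a} {A : Set a} (xss : List (List A)) → length (concat xss) ≡ sum (map length xss)
length-concat [] = refl
length-concat (xs ∷ xss) = trans (length-++ xs) (cong (length xs +_) (length-concat xss))

length-concat-tabulate : ∀ {a} {A : Set a} {k} (f : Fin k → List A) → length (concat (tabulate f)) ≡ ∑ (length ∘ f)
length-concat-tabulate f = trans (length-concat (tabulate f)) (cong sum (map-tabulate f length))

-- A list containing d distinct values has at least d entries: their
-- positions in the list are distinct.
distinct-members⇒≤length : ∀ {a} {A : Set a} {d} (L : List A) (f : Fin d → A) →
                           Injective _≡_ _≡_ f → (∀ i → f i ∈ L) → d ≤ length L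
distinct-members⇒≤length L f f-injective f∈L = FinP.injective⇒≤ position-injective
  where
  position-injective : Injective _≡_ _≡_ (λ i → index (f∈L i))
  position-injective {i} {j} same-position = f-injective (begin
    f i                          ≡⟨ lookup-index (f∈L i) ⟩
    lookup L (index (f∈L i))     ≡⟨ cong (lookup L) same-position ⟩
    lookup L (index (f∈L j))     ≡⟨ lookup-index (f∈L j) ⟨
    f j                          ∎)
    where open ≡-Reasoning

initial-segment⇒≤length : ∀ d (L : List ℕ) → (∀ m → m < d → m ∈ L) → d ≤ length L
initial-segment⇒≤length d L below-d∈L =
  distinct-members⇒≤length L toℕ FinP.toℕ-injective (λ i → below-d∈L (toℕ i) (FinP.toℕ<n i))

-- The time at which a vertex is first listed (0 if absent).
timeOf : ∀ {n} → Fin n → List (Fin n × ℕ) → ℕ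
timeOf v [] = 0
timeOf v ((x , a) ∷ r) with v FinP.≟ x
... | yes _ = a
... | no _ = timeOf v r

module _ {n : ℕ} (ℓ : Fin n → Fin n → ℕ) where

  timed-vertex : ∀ τ W {v a} → (v , a) ∈ timed ℓ τ W → v ∈ W
  timed-vertex τ (x ∷ []) (here refl) = here refl
  timed-vertex τ (x ∷ y ∷ r) (here refl) = here refl
  timed-vertex τ (x ∷ y ∷ r) (there p) = there (timed-vertex _ (y ∷ r) p)

  length-timed : ∀ τ W → length (timed ℓ τ W) ≡ length W
  length-timed τ [] = refl
  length-timed τ (x ∷ []) = refl
  length-timed τ (x ∷ y ∷ r) = cong suc (length-timed _ (y ∷ r))

  arrival : ∀ τ W {v} → last W ≡ just v → (v , τ + walkLength ℓ W) ∈ timed ℓ τ W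
  arrival τ (x ∷ []) last≡v = here (cong₂ _,_ (just-injective (sym last≡v)) (+-identityʳ τ))
  arrival τ (x ∷ y ∷ r) {v} last≡v =
    there (subst (λ a → (v , a) ∈ timed ℓ (τ + ℓ x y) (y ∷ r)) (+-assoc τ _ _)
                 (arrival (τ + ℓ x y) (y ∷ r) last≡v))

  timeOf-path : ∀ τ W → Unique W → ∀ {v a} → (v , a) ∈ timed ℓ τ W → timeOf v (timed ℓ τ W) ≡ a
  timeOf-path τ (x ∷ []) _ (here refl) with x FinP.≟ x
  ... | yes _ = refl
  ... | no x≢x = ⊥-elim (x≢x refl)
  timeOf-path τ (x ∷ y ∷ r) _ (here refl) with x FinP.≟ x
  ... | yes _ = refl
  ... | no x≢x = ⊥-elim (x≢x refl)
  timeOf-path τ (x ∷ y ∷ r) (x∉r ∷ path) {v} (there p) with v FinP.≟ x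
  ... | yes refl = ⊥-elim (All.lookup x∉r (timed-vertex _ (y ∷ r) p) refl)
  ... | no _ = timeOf-path _ (y ∷ r) path p

module _ {n : ℕ} {E : Fin n → Fin n → Bool} where

  walk-to-later-vertex : ∀ x r {y} → IsWalk E (x ∷ r) → y ∈ r →
                         Σ (List (Fin n)) λ p → WalkFromTo E x y (x ∷ p) × 1 ≤ length p
  walk-to-later-vertex x (z ∷ r) (x→z , _) (here refl) = (z ∷ []) , ((x→z , tt) , refl , refl) , s≤s z≤n
  walk-to-later-vertex x (z ∷ r) (x→z , walk) (there y∈r) with walk-to-later-vertex z r walk y∈r
  ... | p , ((walk-p , _ , last≡y) , _) = (z ∷ p) , ((x→z , walk-p) , refl , last≡y) , s≤s z≤n

  -- In a DAG every walk is a path: a repeated vertex would close a cycle.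
  dag-walk-unique : IsDAG E → ∀ W → IsWalk E W → Unique W
  dag-walk-unique dag (x ∷ []) _ = [] ∷ []
  dag-walk-unique dag (x ∷ y ∷ r) walk@(_ , walk′) =
    All.tabulate (λ z∈r x≡z → no-cycle z∈r x≡z) ∷ dag-walk-unique dag (y ∷ r) walk′
    where
    no-cycle : ∀ {z} → z ∈ y ∷ r → x ≡ z → ⊥
    no-cycle z∈r refl with walk-to-later-vertex x (y ∷ r) walk z∈r
    ... | p , cycle , 1≤|p| = dag x (x ∷ p) cycle (s≤s 1≤|p|)

  distinct-ends⇒two-vertices : ∀ {u v} W → WalkFromTo E u v W → u ≢ v → 2 ≤ length W
  distinct-ends⇒two-vertices (x ∷ []) (_ , head≡u , last≡v) u≢v =
    ⊥-elim (u≢v (trans (just-injective (sym head≡u)) (just-injective last≡v)))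
  distinct-ends⇒two-vertices (x ∷ y ∷ r) _ _ = s≤s (s≤s z≤n)

  shortest≤walk : ∀ {ℓ u v W W′} → IsDAG E → ShortestPath E ℓ u v W → WalkFromTo E u v W′ →
                  walkLength ℓ W ≤ walkLength ℓ W′
  shortest≤walk {W′ = W′} dag (_ , minimal) walk′ =
    minimal W′ (walk′ , dag-walk-unique dag W′ (proj₁ walk′))

  module _ {ℓ : Fin n → Fin n → ℕ} (positive : PositiveLengths E ℓ) where

    -- Every arc has length ≥ 1, so a walk has at most λ(W) + 1 vertices.
    vertices≤1+length : ∀ W → IsWalk E W → length W ≤ suc (walkLength ℓ W)
    vertices≤1+length (x ∷ []) _ = s≤s z≤n
    vertices≤1+length (x ∷ y ∷ r) (x→y , walk) =
      s≤s (≤-trans (vertices≤1+length (y ∷ r) walk) (+-monoˡ-≤ _ (positive x y x→y)))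

    walk-length-positive : ∀ W → IsWalk E W → 2 ≤ length W → 1 ≤ walkLength ℓ W
    walk-length-positive W walk 2≤|W| = s≤s⁻¹ (≤-trans 2≤|W| (vertices≤1+length W walk))

    vertices≤2*length : ∀ {u v} W → WalkFromTo E u v W → u ≢ v → length W ≤ 2 * walkLength ℓ W
    vertices≤2*length W walk u≢v = begin
      length W            ≤⟨ vertices≤1+length W (proj₁ walk) ⟩
      1 + walkLength ℓ W  ≤⟨ +-monoˡ-≤ (walkLength ℓ W) 1≤λ ⟩
      λW + λW             ≡⟨ cong (λW +_) (+-identityʳ λW) ⟨
      2 * λW              ∎
      where
      open ≤-Reasoning
      λW : ℕ
      λW = walkLength ℓ W
      1≤λ : 1 ≤ λW
      1≤λ = walk-length-positive W (proj₁ walk) (distinct-ends⇒two-vertices W walk u≢v)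

module _ {n k : ℕ} (ℓ : Fin n → Fin n → ℕ) (rank : Fin k → Fin k)
         (d : Fin k → ℕ) (W : Fin k → List (Fin n)) where

  -- The value d_h + a - (time of v on W_i) contributed to B_i by the timed
  -- vertex (v , a) of W_h.
  offset : Fin k → Fin k → Fin n × ℕ → ℕ
  offset i h (v , a) = d h + a ∸ timeOf v (timed ℓ 0 (W i))

  candidates : Fin k → List ℕ
  candidates i = concat (tabulate (λ h → map (offset i h) (timed ℓ 0 (W h))))

  B⊆candidates : ∀ {i m} → Unique (W i) → InB ℓ rank d W i m → m ∈ candidates i
  B⊆candidates {i} {m} path (h , _ , v , a , b , va∈W_h , vb∈W_i , m+b≡) =
    subst (_∈ candidates i) offset≡m
          (∈-concat⁺′ (∈-map⁺ (offset i h) va∈W_h) (∈-tabulate⁺ h))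
    where
    open ≡-Reasoning
    offset≡m : offset i h (v , a) ≡ m
    offset≡m = begin
      d h + a ∸ timeOf v (timed ℓ 0 (W i)) ≡⟨ cong (d h + a ∸_) (timeOf-path ℓ 0 (W i) path vb∈W_i) ⟩
      d h + a ∸ b                          ≡⟨ cong (_∸ b) m+b≡ ⟨
      m + b ∸ b                            ≡⟨ m+n∸n≡m m b ⟩
      m                                    ∎

  length-candidates : ∀ i → length (candidates i) ≡ ∑ (λ h → length (W h))
  length-candidates i = trans (length-concat-tabulate (λ h → map (offset i h) (timed ℓ 0 (W h))))
    (∑-cong (λ h → trans (length-map (offset i h) (timed ℓ 0 (W h))) (length-timed ℓ 0 (W h))))

  greedy-delay-bound : ∀ i → Unique (W i) → (∀ m → m < d i → InB ℓ rank d W i m) →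
                       d i ≤ ∑ (λ h → length (W h))
  greedy-delay-bound i path below-d∈B = ≤-trans
    (initial-segment⇒≤length (d i) (candidates i) (λ m m<d → B⊆candidates path (below-d∈B m m<d)))
    (≤-reflexive (length-candidates i))

upper-bound : ∀ {n k} (E : Fin n → Fin n → Bool) (ℓ : Fin n → Fin n → ℕ) (s t : Fin k → Fin n) →
              IsTDWInstance E ℓ s t → IsDAG E →
              ∀ W rank d → AlgorithmRun E ℓ s t W rank d →
              ∀ d′ W′ → Feasible E ℓ s t d′ W′ →
              cost ℓ d W ≤ 3 * k * cost ℓ d′ W′
upper-bound {k = k} E ℓ s t (positive , _ , _ , s≢t , _) dag W rank d (shortest , _ , _ , _ , below-d∈B) d′ W′ (walks′ , _) =
  begin
    cost ℓ d W                  ≤⟨ ∑-mono per-demand ⟩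
    ∑ {k} (λ _ → 2 * OPT + OPT) ≡⟨ ∑-const k _ ⟩
    k * (2 * OPT + OPT)         ≡⟨ three k OPT ⟩
    3 * k * OPT                 ∎
  where
  open ≤-Reasoning
  OPT : ℕ
  OPT = cost ℓ d′ W′
  three : ∀ k c → k * (2 * c + c) ≡ 3 * k * c
  three = solve-∀
  opt-part : ∀ i → d′ i + walkLength ℓ (W′ i) ≤ OPT
  opt-part = term≤∑ (λ i → d′ i + walkLength ℓ (W′ i))
  W≤W′ : ∀ i → walkLength ℓ (W i) ≤ d′ i + walkLength ℓ (W′ i)
  W≤W′ i = ≤-trans (shortest≤walk dag (shortest i) (walks′ i)) (m≤n+m _ _)
  vertices : ∀ h → length (W h) ≤ 2 * (d′ h + walkLength ℓ (W′ h))
  vertices h = ≤-trans (vertices≤2*length positive (W h) (proj₁ (proj₁ (shortest h))) (s≢t h h))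
                       (*-monoʳ-≤ 2 (W≤W′ h))
  delay : ∀ i → d i ≤ 2 * OPT
  delay i = ≤-trans (greedy-delay-bound ℓ rank d W i (proj₂ (proj₁ (shortest i))) (below-d∈B i))
                    (≤-trans (∑-mono vertices) (≤-reflexive (∑-scale 2 (λ h → d′ h + walkLength ℓ (W′ h)))))
  per-demand : ∀ i → d i + walkLength ℓ (W i) ≤ 2 * OPT + OPT
  per-demand i = +-mono-≤ (delay i) (≤-trans (W≤W′ i) (opt-part i))

-- Layered digraphs: an arc u → v exactly when v is higher than u, of length
-- equal to the height difference.  A walk's clock then reads its height gain.

module Layered {n : ℕ} (height : Fin n → ℕ) where

  E : Fin n → Fin n → Bool
  E u v = height u <ᵇ height v

  ℓ : Fin n → Fin n → ℕ
  ℓ u v = height v ∸ height u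

  arc-up : ∀ {u v} → Arc E u v → height u < height v
  arc-up {u} {v} u→v = <ᵇ⇒< (height u) (height v) (Equivalence.from T-≡ u→v)

  up-arc : ∀ u v → height u < height v → Arc E u v
  up-arc u v u<v = Equivalence.to T-≡ (<⇒<ᵇ u<v)

  positive : PositiveLengths E ℓ
  positive u v u→v = m<n⇒0<n∸m (arc-up u→v)

  timed-height : ∀ τ x r {v a} → IsWalk E (x ∷ r) → (v , a) ∈ timed ℓ τ (x ∷ r) →
                 a + height x ≡ τ + height v
  timed-height τ x [] _ (here refl) = refl
  timed-height τ x (y ∷ r) _ (here refl) = refl
  timed-height τ x (y ∷ r) {v} {a} (x→y , walk) (there p) = +-cancelʳ-≡ δ _ _ (begin
    a + height x + δ     ≡⟨ +-assoc a _ _ ⟩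
    a + (height x + δ)   ≡⟨ cong (a +_) (+-comm (height x) δ) ⟩
    a + (δ + height x)   ≡⟨ cong (a +_) (m∸n+n≡m (<⇒≤ (arc-up x→y))) ⟩
    a + height y         ≡⟨ timed-height (τ + δ) y r walk p ⟩
    τ + δ + height v     ≡⟨ +-assoc τ δ _ ⟩
    τ + (δ + height v)   ≡⟨ cong (τ +_) (+-comm δ _) ⟩
    τ + (height v + δ)   ≡⟨ +-assoc τ _ δ ⟨
    τ + height v + δ     ∎)
    where
    open ≡-Reasoning
    δ : ℕ
    δ = ℓ x y

  walk-length-height : ∀ {u v} W → WalkFromTo E u v W → walkLength ℓ W + height u ≡ height v
  walk-length-height (x ∷ r) (walk , refl , last≡v) = timed-height 0 x r walk (arrival ℓ 0 (x ∷ r) last≡v)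

  acyclic : IsDAG E
  acyclic v W cycle 2≤|W| = <⇒≢ 0<λ (sym (+-cancelʳ-≡ (height v) _ 0 (walk-length-height W cycle)))
    where
    0<λ : 0 < walkLength ℓ W
    0<λ = walk-length-positive positive W (proj₁ cycle) 2≤|W|

  -- All walks with the same ends have the same length, so every path is shortest.
  every-path-shortest : ∀ {u v W} → PathFromTo E u v W → ShortestPath E ℓ u v W
  every-path-shortest {u} {W = W} path@(walk , _) = path , λ W′ (walk′ , _) →
    ≤-reflexive (+-cancelʳ-≡ (height u) _ _
      (trans (walk-length-height W walk) (sym (walk-length-height W′ walk′))))

-- The star instance: sources s_i at height 0, a centre at height 1, sinks t_j
-- at height 2; vertex fz is the centre, fs (i ↑ˡ k) is s_i, fs (k ↑ʳ i) is t_i.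

module Star (k : ℕ) where

  height : Fin (suc (k + k)) → ℕ
  height fz = 1
  height (fs u) = [ (λ _ → 0) , (λ _ → 2) ]′ (splitAt k u)

  open Layered height public

  V : Set
  V = Fin (suc (k + k))

  centre : V
  centre = fz

  s t : Fin k → V
  s i = fs (i ↑ˡ k)
  t i = fs (k ↑ʳ i)

  source-height : ∀ i → height (s i) ≡ 0
  source-height i rewrite FinP.splitAt-↑ˡ k i k = refl

  sink-height : ∀ i → height (t i) ≡ 2
  sink-height i rewrite FinP.splitAt-↑ʳ k k i = refl

  s-injective : Injective _≡_ _≡_ s
  s-injective {i} {j} si≡sj = FinP.↑ˡ-injective k i j (FinP.suc-injective si≡sj)

  t-injective : Injective _≡_ _≡_ t
  t-injective {i} {j} ti≡tj = FinP.↑ʳ-injective k i j (FinP.suc-injective ti≡tj)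

  s≢t : ∀ i j → s i ≢ t j
  s≢t i j si≡tj with trans (sym (source-height i)) (trans (cong height si≡tj) (sink-height j))
  ... | ()

  source→centre : ∀ i → Arc E (s i) centre
  source→centre i = up-arc (s i) centre (subst (_< 1) (sym (source-height i)) (s≤s z≤n))

  centre→sink : ∀ i → Arc E centre (t i)
  centre→sink i = up-arc centre (t i) (subst (1 <_) (sym (sink-height i)) (s≤s (s≤s z≤n)))

  source→sink : ∀ i j → Arc E (s i) (t j)
  source→sink i j = up-arc (s i) (t j) (subst₂ _<_ (sym (source-height i)) (sym (sink-height j)) (s≤s z≤n))

  direct : Fin k → List V
  direct i = s i ∷ t i ∷ []

  direct-walk : ∀ i → WalkFromTo E (s i) (t i) (direct i)
  direct-walk i = (source→sink i i , tt) , refl , refl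

  star-instance : IsTDWInstance E ℓ s t
  star-instance = positive , s-injective , t-injective , s≢t , (λ i → direct i , direct-walk i)

  via-centre : Fin k → List V
  via-centre i = s i ∷ centre ∷ t i ∷ []

  via-centre-walk : ∀ i → WalkFromTo E (s i) (t i) (via-centre i)
  via-centre-walk i = (source→centre i , centre→sink i , tt) , refl , refl

  demand-length : ∀ i W → WalkFromTo E (s i) (t i) W → walkLength ℓ W ≡ 2
  demand-length i W walk = begin
    walkLength ℓ W              ≡⟨ +-identityʳ _ ⟨
    walkLength ℓ W + 0          ≡⟨ cong (walkLength ℓ W +_) (source-height i) ⟨
    walkLength ℓ W + height (s i) ≡⟨ walk-length-height W walk ⟩
    height (t i)                ≡⟨ sink-height i ⟩
    2                           ∎
    where open ≡-Reasoning

  via-centre-shortest : ∀ i → ShortestPath E ℓ (s i) (t i) (via-centre i)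
  via-centre-shortest i = every-path-shortest
    (via-centre-walk i , dag-walk-unique acyclic (via-centre i) (proj₁ (via-centre-walk i)))

  time-is-height : ∀ h {v a} → (v , a) ∈ timed ℓ 0 (via-centre h) → a ≡ height v
  time-is-height h {v} {a} va∈ = begin
    a                  ≡⟨ +-identityʳ a ⟨
    a + 0              ≡⟨ cong (a +_) (source-height h) ⟨
    a + height (s h)   ≡⟨ timed-height 0 (s h) _ (proj₁ (via-centre-walk h)) va∈ ⟩
    height v           ∎
    where open ≡-Reasoning

  centre-at-1 : ∀ h → (centre , 1) ∈ timed ℓ 0 (via-centre h)
  centre-at-1 h = there (here (cong (centre ,_) (cong (1 ∸_) (sym (source-height h)))))

  -- Processing demands in index order, demand i gets delay i: every earlier
  -- demand occupies the centre at a distinct shifted time, and all demands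
  -- meet any common vertex at the same time.
  delay-not-blocked : ∀ i → ¬ InB ℓ id toℕ via-centre i (toℕ i)
  delay-not-blocked i (h , h<i , v , a , b , va∈ , vb∈ , i+b≡h+a) =
    <⇒≢ h<i (sym (+-cancelʳ-≡ (height v) _ _ (begin
      toℕ i + height v  ≡⟨ cong (toℕ i +_) (time-is-height i vb∈) ⟨
      toℕ i + b         ≡⟨ i+b≡h+a ⟩
      toℕ h + a         ≡⟨ cong (toℕ h +_) (time-is-height h va∈) ⟩
      toℕ h + height v  ∎)))
    where open ≡-Reasoning

  smaller-delays-blocked : ∀ i m → m < toℕ i → InB ℓ id toℕ via-centre i m
  smaller-delays-blocked i m m<i =
    h , subst (_< toℕ i) (sym toℕh≡m) m<i , centre , 1 , 1 , centre-at-1 h , centre-at-1 i ,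
    cong (_+ 1) (sym toℕh≡m)
    where
    m<k : m < k
    m<k = <-trans m<i (FinP.toℕ<n i)
    h : Fin k
    h = fromℕ< m<k
    toℕh≡m : toℕ h ≡ m
    toℕh≡m = FinP.toℕ-fromℕ< m<k

  greedy-run : AlgorithmRun E ℓ s t via-centre id toℕ
  greedy-run = via-centre-shortest , id ,
    (λ i j _ → ≤-reflexive (trans (demand-length i (via-centre i) (via-centre-walk i))
                                  (sym (demand-length j (via-centre j) (via-centre-walk j))))) ,
    delay-not-blocked , smaller-delays-blocked

  -- Direct arcs at time 0 never meet: distinct demands have distinct ends.
  direct-feasible : Feasible E ℓ s t (λ _ → 0) direct
  direct-feasible = direct-walk , disjoint
    where
    disjoint : ∀ i j → i ≢ j → TimeDisjoint ℓ 0 (direct i) 0 (direct j)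
    disjoint i j i≢j v τ (here refl) (here eq) = i≢j (s-injective (cong proj₁ eq))
    disjoint i j i≢j v τ (here refl) (there (here eq)) = s≢t i j (cong proj₁ eq)
    disjoint i j i≢j v τ (there (here refl)) (here eq) = s≢t j i (sym (cong proj₁ eq))
    disjoint i j i≢j v τ (there (here refl)) (there (here eq)) = i≢j (t-injective (cong proj₁ eq))

  -- k · OPT = 2k² ≤ 4 Σ_i (i + 2) = 4 · (greedy cost).
  ratio : 1 * k * cost ℓ (λ _ → 0) direct ≤ 4 * cost ℓ toℕ via-centre
  ratio = begin
    1 * k * cost ℓ (λ _ → 0) direct  ≡⟨ cong (1 * k *_) (trans (∑-cong (λ i → demand-length i (direct i) (direct-walk i))) (∑-const k 2)) ⟩
    1 * k * (k * 2)                  ≡⟨ square k ⟩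
    2 * (k * k)                      ≤⟨ m≤m+n _ _ ⟩
    2 * (k * k) + 6 * k              ≡⟨ +-cancelʳ-≡ (2 * k) _ _ (trans (regroup G k) (trans (cong (2 *_) (∑-index-offset k 2)) (double k))) ⟨
    4 * G                            ≡⟨ cong (4 *_) (∑-cong (λ i → cong (toℕ i +_) (demand-length i (via-centre i) (via-centre-walk i)))) ⟨
    4 * cost ℓ toℕ via-centre        ∎
    where
    open ≤-Reasoning
    G : ℕ
    G = ∑ {k} (λ i → toℕ i + 2)
    square : ∀ k → 1 * k * (k * 2) ≡ 2 * (k * k)
    square = solve-∀
    regroup : ∀ S k → 4 * S + 2 * k ≡ 2 * (2 * S + k)
    regroup = solve-∀
    double : ∀ k → 2 * (k * k + 2 * 2 * k) ≡ 2 * (k * k) + 6 * k + 2 * k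
    double = solve-∀

theorem6p3 :
    (Σ ℕ λ C →
      ∀ (n k : ℕ) (E : Fin n → Fin n → Bool) (ℓ : Fin n → Fin n → ℕ)
        (s t : Fin k → Fin n) →
        IsTDWInstance E ℓ s t → IsDAG E →
        ∀ (W : Fin k → List (Fin n)) (rank : Fin k → Fin k) (d : Fin k → ℕ) →
        AlgorithmRun E ℓ s t W rank d →
        ∀ (d′ : Fin k → ℕ) (W′ : Fin k → List (Fin n)) →
        Feasible E ℓ s t d′ W′ →
        cost ℓ d W ≤ C * k * cost ℓ d′ W′)
    ×
    (Σ ℕ λ p → Σ ℕ λ q → 1 ≤ p × 1 ≤ q ×
      (∀ (k : ℕ) → 1 ≤ k →
        Σ ℕ λ n → Σ (Fin n → Fin n → Bool) λ E → Σ (Fin n → Fin n → ℕ) λ ℓ →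
        Σ (Fin k → Fin n) λ s → Σ (Fin k → Fin n) λ t →
        IsTDWInstance E ℓ s t × IsDAG E ×
        (Σ (Fin k → List (Fin n)) λ W → Σ (Fin k → Fin k) λ rank → Σ (Fin k → ℕ) λ d →
         AlgorithmRun E ℓ s t W rank d ×
         (Σ (Fin k → ℕ) λ d′ → Σ (Fin k → List (Fin n)) λ W′ →
          Feasible E ℓ s t d′ W′ ×
          p * k * cost ℓ d′ W′ ≤ q * cost ℓ d W))))
theorem6p3 =
  (3 , λ n k → upper-bound) ,
  (1 , 4 , s≤s z≤n , s≤s z≤n , λ k _ → let open Star k in
    suc (k + k) , E , ℓ , s , t , star-instance , acyclic ,
    via-centre , id , toℕ , greedy-run ,
    (λ _ → 0) , direct , direct-feasible , ratio)
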